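{- Consider standard, range-restricted logic programs in which, whenever a variable $X$ occurs both in a term of the head and in a term of the body of a rule, at most one of these terms is complex, and every complex term has nesting depth at most one. For every natural number $k\ge1$, the class of $(k+1)$-safe programs strictly contains the class of $k$-safe programs.
   Context: Terms: constants, variables (simple) or $f(t_1,\dots,t_m)$ (complex). A standard rule is $A\leftarrow B_1,\dots,B_k$; a program is a finite set of rules. $p[i]$ is the $i$-th argument of $p$; $args(P)$ the set of arguments; $F_P$ the function symbols; $var(\cdot)$ variables. $AR(P)$: depth $d(u,u)=0$, $d(u,f(t_1,\dots,t_m))=1+\max_{i:\,t_i\text{ contains }u}d(u,t_i)$; $\Omega(\phi)(p[i])=\max(\max\{D(r,i,X)\},0)$ (max over rules $r$ with head $p(t_1,\dots,t_n)$, variables $X$ in $t_i$), $D(r,i,X)=\min\{d(X,t_i)-d(X,u_j)+\phi(q[j])\mid q(u_1,\dots,u_m)\text{ in body of }r,\ X\text{ in }u_j\}$; with $\phi_0\equiv0$, $AR(P)$ = arguments where the nondecreasing sequence $\Omega^k(\phi_0)(p[i])$ is eventually constant. $\mathit{GA}(P)$: labeled argument graph on $args(P)$ with, for rule $r$ with head $p(v_1,\dots,v_n)$, body atom $q(u_1,\dots,u_m)$, common variable $X$ of $u_j,v_i$, an edge $(q[j],p[i],\alpha)$, $\alpha=\epsilon$ if $u_j=v_i=X$, $f$ if $u_j=X$, $v_i=f(\dots,X,\dots)$, $\overline f$ if $u_j=f(\dots,X,\dots)$, $v_i=X$; paths spell concatenated labels; grammar $\Gamma_P$, start $S$, productions $S\to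 S_1fS_2$, $S_1\to fS_1\overline fS_1\mid\epsilon$, $S_2\to S_1S_2\mid fS_2\mid\epsilon$ ($f\in F_P$); $\Delta(P)$ = labeled argument graph minus edges ending in $AR(P)$; a node depends on a cycle if a node of the cycle reaches it by a path; $\mathit{GA}(P)$ = arguments not depending on a cyclic path of $\Delta(P)$ spelling a string of $\mathcal L(\Gamma_P)$. Recursion: $p$ depends on $q$ if a rule has $p$ in head and $q$ in body, or transitively; mutually recursive if each depends on the other; $rbody(r)$ = body atoms with predicates mutually recursive with the head predicate; a recursive rule defining $p$ is strongly linear if $|rbody(r)|\le1$, the atom's predicate is $p$, and no other recursive rule defines $p$. For $r=q(t_1,\dots,t_m)\leftarrow body(r)$, $t_i$ is limited in $r$ w.r.t. a set of arguments $A$ if (1) each variable of $t_i$ occurs in a term $u_j$ of a body atom $p(u_1,\dots,u_n)$ with $p[j]\in A$, or (2) $r$ is strongly linear, each atom of $\{head(r)\}\cup rbody(r)$ has all terms simple or all complex, $var(head(r))=var(rbody(r))$, and $q[j]\in A$ for some $j$. Activation graph $\Sigma(P)$: nodes rules, edge $(r_1,r_2)$ iff $head(r_1)$ unifies with an atom of $body(r_2)$. A path $(r_1,r_2),\dots,(r_k,r_{k+1})$ of $\Sigma(P)$ is active if there are unifiers $\theta_1,\dots,\theta_k$ such that $head(r_1)$ unifies with an atom of $body(r_2)$ via $\theta_1$ and, for $i\in[2..k]$, $head(r_i)\theta_{i-1}$ unifies with an atom of $body(r_{i+1})$ via $\theta_i$. The $k$-restricted activation graph $\Sigma_k(P)$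 has the rules as nodes and an edge $(r,s)$ iff there is an active path of length $k$ from $r$ to $s$ ($\Sigma_1(P)=\Sigma(P)$). The $k$-safety function $\Psi_k(A)$ is the set of $q[i]\in args(P)$ such that for every rule $r$ with head $q(t_1,\dots,t_m)$, either $r$ does not depend on a cycle of $\Sigma_j(P)$ for some $1\le j\le k$, or $t_i$ is limited in $r$ w.r.t. $A$. $safe_k(P)=\Psi_k^\infty(\mathit{GA}(P))$, the limit of the iterates $\Psi_k^i(\mathit{GA}(P))$; $P$ is $k$-safe iff $safe_k(P)=args(P)$. -}

module Defs where

open import Data.Nat using (ℕ; zero; suc; _≤_; _<_; _⊔_) renaming (_≟_ to _≟ℕ_)
open import Data.Integer as ℤ using (ℤ; +_; ∣_∣)
open import Data.Bool using (Bool; true; false; if_then_else_; _∧_; _∨_)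
open import Data.List using (List; []; _∷_; _++_; length; concatMap; foldr)
open import Data.List.Membership.Propositional using (_∈_)
open import Data.List.Relation.Unary.All using (All)
open import Data.Maybe using (Maybe; just; nothing)
open import Data.Product using (Σ; ∃; ∃-syntax; _×_; _,_; proj₁; proj₂)
open import Data.Sum using (_⊎_)
open import Relation.Nullary using (¬_)
open import Relation.Nullary.Decidable using (⌊_⌋)
open import Relation.Binary.PropositionalEquality using (_≡_; _≢_)
open import Relation.Binary.Construct.Closure.Transitive using (TransClosure)
open import Relation.Binary.Construct.Closure.ReflexiveTransitive using (Star)
open import Function.Bundles using (_⇔_)

-- Variables, constants, predicate names and function names are ℕ-codes.
-- A predicate symbol is identified by (name , arity), likewise a
-- function symbol, so every symbol has a fixed arity.

Var : Set
Var = ℕ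

data Term : Set where
  var   : Var → Term
  const : ℕ → Term
  fn    : ℕ → List Term → Term

record Atom : Set where
  constructor atom
  field
    pname : ℕ
    targs : List Term
open Atom public

record Rule : Set where
  constructor _⟵_
  field
    head : Atom
    body : List Atom
open Rule public

Program : Set
Program = List Rule

Pred : Set
Pred = ℕ × ℕ

FunSym : Set
FunSym = ℕ × ℕ

predOf : Atom → Pred
predOf a = pname a , length (targs a)

-- argument p[i]  (i is 0-based: p[i] with 0 ≤ i < arity p)
Arg : Set
Arg = Pred × ℕ

nth : {A : Set} → List A → ℕ → Maybe A
nth []       _       = nothing
nth (x ∷ xs) zero    = just x
nth (x ∷ xs) (suc n) = nth xs n

enumFrom : {A : Set} → ℕ → List A → List (ℕ × A)
enumFrom n []       = []
enumFrom n (x ∷ xs) = (n , x) ∷ enumFrom (suc n) xs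

mutual
  varsT : Term → List Var
  varsT (var x)   = x ∷ []
  varsT (const c) = []
  varsT (fn f ts) = varsTs ts

  varsTs : List Term → List Var
  varsTs []       = []
  varsTs (t ∷ ts) = varsT t ++ varsTs ts

varsA : Atom → List Var
varsA a = varsTs (targs a)

mutual
  occurs : Var → Term → Bool
  occurs x (var y)   = ⌊ x ≟ℕ y ⌋
  occurs x (const c) = false
  occurs x (fn f ts) = occursL x ts

  occursL : Var → List Term → Bool
  occursL x []       = false
  occursL x (t ∷ ts) = occurs x t ∨ occursL x ts

-- d(X,t): d(X,X) = 0, d(X,f(t₁..tₘ)) = 1 + max{ d(X,tᵢ) | tᵢ contains X }
-- (only used when X occurs in t)
mutual
  depth : Var → Term → ℕ
  depth x (var y)   = 0
  depth x (const c) = 0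
  depth x (fn f ts) = suc (depthL x ts)

  depthL : Var → List Term → ℕ
  depthL x []       = 0
  depthL x (t ∷ ts) = if occurs x t then depth x t ⊔ depthL x ts else depthL x ts

Subst : Set
Subst = Var → Term

mutual
  sub : Subst → Term → Term
  sub σ (var x)   = σ x
  sub σ (const c) = const c
  sub σ (fn f ts) = fn f (subs σ ts)

  subs : Subst → List Term → List Term
  subs σ []       = []
  subs σ (t ∷ ts) = sub σ t ∷ subs σ ts

subA : Subst → Atom → Atom
subA σ (atom p ts) = atom p (subs σ ts)

OccursAtom : Program → Atom → Set
OccursAtom P a = ∃[ r ] (r ∈ P × (a ≡ head r ⊎ a ∈ body r))

InArgs : Program → Arg → Set
InArgs P (p , i) = ∃[ a ] (OccursAtom P a × predOf a ≡ p) × i < proj₂ p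

Simple : Term → Set
Simple t = (∃[ x ] t ≡ var x) ⊎ (∃[ c ] t ≡ const c)

Complex : Term → Set
Complex t = ∃[ f ] ∃[ ts ] t ≡ fn f ts

RangeRestricted : Program → Set
RangeRestricted P = ∀ r → r ∈ P → ∀ x → x ∈ varsA (head r) →
  ∃[ b ] (b ∈ body r × x ∈ varsA b)

NestingAtMostOne : Term → Set
NestingAtMostOne t = Simple t ⊎ (∃[ f ] ∃[ ts ] (t ≡ fn f ts × All Simple ts))

InClass : Program → Set
InClass P =
  RangeRestricted P ×
  (∀ r → r ∈ P → ∀ t u b x → t ∈ targs (head r) → b ∈ body r → u ∈ targs b →
     x ∈ varsT t → x ∈ varsT u → Simple t ⊎ Simple u) ×
  (∀ a → OccursAtom P a → ∀ t → t ∈ targs a → NestingAtMostOne t)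

_≟P_ : Pred → Pred → Bool
(p , m) ≟P (q , n) = ⌊ p ≟ℕ q ⌋ ∧ ⌊ m ≟ℕ n ⌋

minL : List ℤ → Maybe ℤ
minL []       = nothing
minL (z ∷ zs) with minL zs
... | nothing = just z
... | just w  = just (z ℤ.⊓ w)

maybeL : {A : Set} → Maybe A → List A
maybeL nothing  = []
maybeL (just x) = x ∷ []

-- D(r,i,X) where tᵢ = t; min over body atoms q(u₁..uₘ) and j with X in uⱼ
-- (nothing if that set is empty, which cannot happen for range-restricted P)
Dval : (Arg → ℕ) → Rule → Term → Var → Maybe ℤ
Dval φ r t x = minL (concatMap
  (λ b → concatMap
     (λ ju → if occurs x (proj₂ ju)
               then ((+ depth x t) ℤ.- (+ depth x (proj₂ ju)) ℤ.+ (+ φ (predOf b , proj₁ ju))) ∷ []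
               else [])
     (enumFrom 0 (targs b)))
  (body r))

Ω : Program → (Arg → ℕ) → Arg → ℕ
Ω P φ (p , i) = ∣ foldr ℤ._⊔_ (+ 0) (concatMap
  (λ r → if predOf (head r) ≟P p
           then (rest r (nth (targs (head r)) i))
           else [])
  P) ∣
  where
  rest : Rule → Maybe Term → List ℤ
  rest r nothing  = []
  rest r (just t) = concatMap (λ x → maybeL (Dval φ r t x)) (varsT t)

Ωiter : Program → ℕ → Arg → ℕ
Ωiter P zero    = λ _ → 0
Ωiter P (suc n) = Ω P (Ωiter P n)

AR : Program → Arg → Set
AR P a = InArgs P a × ∃[ n ] (∀ m → n ≤ m → Ωiter P m a ≡ Ωiter P n a)

data Label : Set where
  ε    : Label
  lab  : FunSym → Label
  labᵇ : FunSym → Label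

data Letter : Set where
  ⟨_⟩  : FunSym → Letter
  ⟨_⟩ᵇ : FunSym → Letter

spell : Label → List Letter
spell ε        = []
spell (lab f)  = ⟨ f ⟩ ∷ []
spell (labᵇ f) = ⟨ f ⟩ᵇ ∷ []

data GEdge (P : Program) : Arg → Arg → Label → Set where
  eps : ∀ {r b i j x} → r ∈ P → b ∈ body r →
        nth (targs b) j ≡ just (var x) → nth (targs (head r)) i ≡ just (var x) →
        GEdge P (predOf b , j) (predOf (head r) , i) ε
  fwd : ∀ {r b i j x f ts} → r ∈ P → b ∈ body r →
        nth (targs b) j ≡ just (var x) → nth (targs (head r)) i ≡ just (fn f ts) →
        var x ∈ ts →
        GEdge P (predOf b , j) (predOf (head r) , i) (lab (f , length ts))
  bwd : ∀ {r b i j x f ts} → r ∈ P → b ∈ body r →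
        nth (targs b) j ≡ just (fn f ts) → var x ∈ ts →
        nth (targs (head r)) i ≡ just (var x) →
        GEdge P (predOf b , j) (predOf (head r) , i) (labᵇ (f , length ts))

data InS1 : List Letter → Set where
  s1ε : InS1 []
  s1f : ∀ {f w₁ w₂} → InS1 w₁ → InS1 w₂ → InS1 (⟨ f ⟩ ∷ w₁ ++ ⟨ f ⟩ᵇ ∷ w₂)

data InS2 : List Letter → Set where
  s2ε : InS2 []
  s2c : ∀ {w₁ w₂} → InS1 w₁ → InS2 w₂ → InS2 (w₁ ++ w₂)
  s2f : ∀ {f w} → InS2 w → InS2 (⟨ f ⟩ ∷ w)

data InL : List Letter → Set where
  sS : ∀ {f w₁ w₂} → InS1 w₁ → InS2 w₂ → InL (w₁ ++ ⟨ f ⟩ ∷ w₂)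

ΔEdge : Program → Arg → Arg → Label → Set
ΔEdge P a b l = GEdge P a b l × ¬ AR P b

data Walk (P : Program) : Arg → Arg → List Letter → Set where
  nil  : ∀ {a} → Walk P a a []
  cons : ∀ {a b c l w} → ΔEdge P a b l → Walk P b c w → Walk P a c (spell l ++ w)

CyclicPath : Program → Arg → List Letter → Set
CyclicPath P c w = ∃[ b ] ∃[ l ] ∃[ w' ] (ΔEdge P c b l × Walk P b c w' × w ≡ spell l ++ w')

-- a depends on a cyclic path spelling a string of L(Γ_P)
-- (every node of a cycle is reached from its start node c and vice versa,
--  so "some node of the cycle reaches a" is "c reaches a")
DependsOnBadCycle : Program → Arg → Set
DependsOnBadCycle P a =
  ∃[ c ] ∃[ w ] (CyclicPath P c w × InL w × ∃[ w' ] Walk P c a w')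

GA : Program → Arg → Set
GA P a = InArgs P a × ¬ DependsOnBadCycle P a

DirectDep : Program → Pred → Pred → Set
DirectDep P p q = ∃[ r ] (r ∈ P × predOf (head r) ≡ p × ∃[ b ] (b ∈ body r × predOf b ≡ q))

DependsOn : Program → Pred → Pred → Set
DependsOn P = TransClosure (DirectDep P)

MutRec : Program → Pred → Pred → Set
MutRec P p q = DependsOn P p q × DependsOn P q p

InRBody : Program → Rule → Atom → Set
InRBody P r a = a ∈ body r × MutRec P (predOf (head r)) (predOf a)

Recursive : Program → Rule → Set
Recursive P r = ∃[ a ] InRBody P r a

StronglyLinear : Program → Rule → Set
StronglyLinear P r =
  ∃[ a ] (InRBody P r a × (∀ a' → InRBody P r a' → a' ≡ a) ×
          predOf a ≡ predOf (head r)) ×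
  (∀ r' → r' ∈ P → r' ≢ r → predOf (head r') ≡ predOf (head r) → ¬ Recursive P r')

AllSimpleOrAllComplex : Atom → Set
AllSimpleOrAllComplex a = All Simple (targs a) ⊎ All Complex (targs a)

Limited : Program → Rule → Term → (Arg → Set) → Set
Limited P r t A =
  (∀ x → x ∈ varsT t →
     ∃[ b ] ∃[ j ] ∃[ u ] (b ∈ body r × nth (targs b) j ≡ just u ×
                          x ∈ varsT u × A (predOf b , j)))
  ⊎
  (StronglyLinear P r ×
   AllSimpleOrAllComplex (head r) ×
   (∀ a → InRBody P r a → AllSimpleOrAllComplex a) ×
   (∀ x → (x ∈ varsA (head r)) ⇔ (∃[ a ] (InRBody P r a × x ∈ varsA a))) ×
   ∃[ j ] (j < length (targs (head r)) × A (predOf (head r) , j)))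

-- Renaming apart is modelled by
-- allowing independent substitutions σ (for h) and τ (for the next rule).
data Act (P : Program) : Atom → ℕ → Rule → Set where
  last : ∀ {h r' b} (σ τ : Subst) → r' ∈ P → b ∈ body r' →
         subA σ h ≡ subA τ b → Act P h 1 r'
  step : ∀ {h r' b n s} (σ τ : Subst) → r' ∈ P → b ∈ body r' →
         subA σ h ≡ subA τ b → Act P (subA τ (head r')) n s → Act P h (suc n) s

ΣEdge : Program → ℕ → Rule → Rule → Set
ΣEdge P k r s = r ∈ P × Act P (head r) k s

DependsOnCycle : Program → ℕ → Rule → Set
DependsOnCycle P k r = ∃[ c ] (TransClosure (ΣEdge P k) c c × Star (ΣEdge P k) c r)

Ψ : Program → ℕ → (Arg → Set) → Arg → Set
Ψ P k A (q , i) = InArgs P (q , i) ×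
  (∀ r → r ∈ P → predOf (head r) ≡ q → ∀ t → nth (targs (head r)) i ≡ just t →
     (∃[ j ] (1 ≤ j × j ≤ k × ¬ DependsOnCycle P j r)) ⊎ Limited P r t A)

Ψiter : Program → ℕ → ℕ → Arg → Set
Ψiter P k zero    = GA P
Ψiter P k (suc n) = Ψ P k (Ψiter P k n)

-- safe_k(P) = limit of the iterates Ψ_k^n(GA(P)): the arguments that
-- eventually belong to every iterate
Safe : Program → ℕ → Arg → Set
Safe P k a = ∃[ n ] (∀ m → n ≤ m → Ψiter P k m a)

KSafe : ℕ → Program → Set
KSafe k P = ∀ a → InArgs P a → Safe P k a

module Submission where

-- Inclusion.  Ψₖ(A) ⊆ Ψₖ₊₁(B) whenever A ⊆ B: the "no cycle in Σⱼ for some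
-- j ≤ k" escape only widens with k and "limited w.r.t. A" is monotone in A.
-- Both iterations start from GA(P), so by induction every iterate for k is
-- contained in the iterate for k+1, and hence so is safeₖ(P).  This needs no
-- assumption on the program (nor k ≥ 1).
--
-- Strictness.  The single rule  p(f(Z), a, X₁,…,Xₖ) ← p(Z, X₁,…,Xₖ, b)  is
-- in the class.  Each firing shifts the constant a one place to the right,
-- so an active path has length at most k: Σₖ₊₁ has no edges at all and
-- every argument is (k+1)-safe, while for j ≤ k the rule lies on a cycle of
-- Σⱼ.  The argument p[0] is not in AR (Ωᵐ(φ₀)(p[0]) = m), the f-labelled
-- self-loop on p[0] spells a word of Γ, so p[0] ∉ GA; and the head term
-- f(Z) is never limited (Z only feeds p[0], and the head mixes simple and
-- complex terms), so p[0] lies in no iterate of Ψₖ.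

open import Defs
open import Data.Nat using (ℕ; zero; suc; _+_; _≤_; _<_; _<ᵇ_; z≤n; s≤s)
open import Data.Nat.Properties
  using (_≟_; _<?_; ≮⇒≥; ≤-refl; ≤-trans; m≤n⇒m≤1+n; m≤m+n; +-suc; +-comm; +-identityʳ; n≤1+n; 1+n≢n; <-irrefl)
open import Data.Integer as ℤ using (ℤ; +_)
open import Data.Bool using (true; false; if_then_else_; _∧_)
open import Data.List using (List; []; _∷_; _++_; length; concatMap)
open import Data.List.Properties using (length-++; ++-assoc)
open import Data.List.Membership.Propositional using (_∈_; _∉_)
open import Data.List.Membership.Propositional.Properties using (∈-++⁺ˡ; ∈-++⁻)
open import Data.List.Relation.Unary.Any using (here; there)
open import Data.List.Relation.Unary.All using (All; []; _∷_; tabulate)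
open import Data.Maybe using (just)
import Data.Maybe as Maybe
open import Data.Maybe.Properties using (just-injective)
open import Data.Product using (Σ; _×_; ∃-syntax; _,_; proj₁; proj₂)
open import Data.Sum using (_⊎_; inj₁; inj₂)
open import Data.Empty using (⊥-elim)
open import Relation.Nullary using (¬_; yes; no)
open import Relation.Nullary.Decidable using (isYes; isYes≗does; dec-true)
open import Relation.Unary using (_⊆_)
open import Relation.Binary.PropositionalEquality
open import Relation.Binary.Construct.Closure.Transitive using (TransClosure; [_]; _∷_)
open import Relation.Binary.Construct.Closure.ReflexiveTransitive using (ε)

limited-mono : ∀ P r t (A B : Arg → Set) → A ⊆ B → Limited P r t A → Limited P r t B
limited-mono P r t A B A⊆B (inj₁ fromBody) = inj₁ λ x x∈t →
  let (b , j , u , b∈ , bj≡u , x∈u , Abj) = fromBody x x∈t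
  in b , j , u , b∈ , bj≡u , x∈u , A⊆B {predOf b , j} Abj
limited-mono P r t A B A⊆B (inj₂ (lin , shape , rshape , vars , j , j< , Aj)) =
  inj₂ (lin , shape , rshape , vars , j , j< , A⊆B {predOf (head r) , j} Aj)

Ψ-mono : ∀ P k (A B : Arg → Set) → A ⊆ B → Ψ P k A ⊆ Ψ P (suc k) B
Ψ-mono P k A B A⊆B (inArgs , eachRule) =
  inArgs , λ r r∈P hd t rᵢ≡t → widen r t (eachRule r r∈P hd t rᵢ≡t)
  where
  widen : ∀ r t → (∃[ j ] (1 ≤ j × j ≤ k × ¬ DependsOnCycle P j r)) ⊎ Limited P r t A →
          (∃[ j ] (1 ≤ j × j ≤ suc k × ¬ DependsOnCycle P j r)) ⊎ Limited P r t B
  widen r t (inj₁ (j , 1≤j , j≤k , acyclic)) = inj₁ (j , 1≤j , m≤n⇒m≤1+n j≤k , acyclic)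
  widen r t (inj₂ lim)                       = inj₂ (limited-mono P r t A B A⊆B lim)

Ψiter-mono : ∀ P k n → Ψiter P k n ⊆ Ψiter P (suc k) n
Ψiter-mono P k zero    inGA = inGA
Ψiter-mono P k (suc n)      = Ψ-mono P k (Ψiter P k n) (Ψiter P (suc k) n) (Ψiter-mono P k n)

ksafe-mono : ∀ k P → KSafe k P → KSafe (suc k) P
ksafe-mono k P safe a inArgs =
  let (n , eventually) = safe a inArgs in n , λ m n≤m → Ψiter-mono P k m (eventually m n≤m)

subs-++ : ∀ σ xs ys → subs σ (xs ++ ys) ≡ subs σ xs ++ subs σ ys
subs-++ σ []       ys = refl
subs-++ σ (x ∷ xs) ys = cong (sub σ x ∷_) (subs-++ σ xs ys)

-- the identity substitution; needed to restart an active path at an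
-- already instantiated head
mutual
  sub-id : ∀ t → sub var t ≡ t
  sub-id (var x)   = refl
  sub-id (const c) = refl
  sub-id (fn f ts) = cong (fn f) (subs-id ts)

  subs-id : ∀ ts → subs var ts ≡ ts
  subs-id []       = refl
  subs-id (t ∷ ts) = cong₂ _∷_ (sub-id t) (subs-id ts)

subA-id : ∀ a → subA var a ≡ a
subA-id (atom p ts) = cong (atom p) (subs-id ts)

varsTs-++ : ∀ xs ys → varsTs (xs ++ ys) ≡ varsTs xs ++ varsTs ys
varsTs-++ []       ys = refl
varsTs-++ (x ∷ xs) ys =
  trans (cong (varsT x ++_) (varsTs-++ xs ys)) (sym (++-assoc (varsT x) (varsTs xs) (varsTs ys)))

nth-subs : ∀ σ ts j → nth (subs σ ts) j ≡ Maybe.map (sub σ) (nth ts j)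
nth-subs σ []       j       = refl
nth-subs σ (t ∷ ts) zero    = refl
nth-subs σ (t ∷ ts) (suc j) = nth-subs σ ts j

nth-++ˡ : ∀ {A : Set} (xs ys : List A) j → j < length xs → nth (xs ++ ys) j ≡ nth xs j
nth-++ˡ (x ∷ xs) ys zero    _         = refl
nth-++ˡ (x ∷ xs) ys (suc j) (s≤s j<n) = nth-++ˡ xs ys j j<n

nth-length : ∀ {A : Set} (xs : List A) y ys → nth (xs ++ y ∷ ys) (length xs) ≡ just y
nth-length []       y ys = refl
nth-length (x ∷ xs) y ys = nth-length xs y ys

nth-∈ : ∀ {A : Set} (xs : List A) j {y} → nth xs j ≡ just y → y ∈ xs
nth-∈ (x ∷ xs) zero    refl = here refl
nth-∈ (x ∷ xs) (suc j) eq   = there (nth-∈ xs j eq)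

≟P-refl : ∀ p → (p ≟P p) ≡ true
≟P-refl (m , n) = cong₂ _∧_ (≟-refl m) (≟-refl n)
  where
  ≟-refl : ∀ m → isYes (m ≟ m) ≡ true
  ≟-refl m = trans (isYes≗does (m ≟ m)) (dec-true (m ≟ m) refl)

absent-no-candidates : ∀ x (g : ℕ × Term → List ℤ) n ts → All (λ t → occurs x t ≡ false) ts →
  concatMap (λ ju → if occurs x (proj₂ ju) then g ju else []) (enumFrom n ts) ≡ []
absent-no-candidates x g n []       []          = refl
absent-no-candidates x g n (t ∷ ts) (absent ∷ rest)
  rewrite absent = absent-no-candidates x g (suc n) ts rest

-- The separating program Pₖ :  p(f(Z), a, X₁,…,Xₖ) ← p(Z, X₁,…,Xₖ, b)
-- with p = f = 0, Z = var 0, Xᵢ = var i, a = const 0, b = const 1.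

Xs : ℕ → ℕ → List Term
Xs s zero    = []
Xs s (suc n) = var (suc s) ∷ Xs (suc s) n

bodyTail : ℕ → List Term
bodyTail k = Xs 0 k ++ const 1 ∷ []

headA bodyA : ℕ → Atom
headA k = atom 0 (fn 0 (var 0 ∷ []) ∷ const 0 ∷ Xs 0 k)
bodyA k = atom 0 (var 0 ∷ bodyTail k)

ruleₖ : ℕ → Rule
ruleₖ k = headA k ⟵ (bodyA k ∷ [])

Pₖ : ℕ → Program
Pₖ k = ruleₖ k ∷ []

length-Xs : ∀ s n → length (Xs s n) ≡ n
length-Xs s zero    = refl
length-Xs s (suc n) = cong suc (length-Xs (suc s) n)

samePred : ∀ k → predOf (bodyA k) ≡ predOf (headA k)
samePred k = cong (λ n → 0 , suc n) (trans (length-++ (Xs 0 k)) (+-comm _ 1))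

∈Xs : ∀ s n {u} → u ∈ Xs s n → ∃[ m ] u ≡ var (suc m)
∈Xs s (suc n) (here refl) = s , refl
∈Xs s (suc n) (there u∈)  = ∈Xs (suc s) n u∈

∈bodyTail : ∀ k {u} → u ∈ bodyTail k → (∃[ m ] u ≡ var (suc m)) ⊎ u ≡ const 1
∈bodyTail k u∈ with ∈-++⁻ (Xs 0 k) u∈
... | inj₁ u∈Xs        = inj₁ (∈Xs 0 k u∈Xs)
... | inj₂ (here refl) = inj₂ refl

Z∉bodyTail : ∀ k {u} → u ∈ bodyTail k → 0 ∉ varsT u
Z∉bodyTail k u∈ with ∈bodyTail k u∈
... | inj₁ (m , refl) = λ { (here ()) ; (there ()) }
... | inj₂ refl       = λ ()

Z-absent : ∀ k → All (λ t → occurs 0 t ≡ false) (bodyTail k)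
Z-absent k = tabulate λ u∈ → absent (∈bodyTail k u∈)
  where
  absent : ∀ {u} → (∃[ m ] u ≡ var (suc m)) ⊎ u ≡ const 1 → occurs 0 u ≡ false
  absent (inj₁ (m , refl)) = refl
  absent (inj₂ refl)       = refl

body-simple : ∀ k {u} → u ∈ targs (bodyA k) → Simple u
body-simple k (here refl) = inj₁ (0 , refl)
body-simple k (there u∈) with ∈bodyTail k u∈
... | inj₁ (m , refl) = inj₁ (suc m , refl)
... | inj₂ refl       = inj₂ (1 , refl)

Pₖ-inClass : ∀ k → InClass (Pₖ k)
Pₖ-inClass k = rangeRestricted , oneSideSimple , shallow
  where
  rangeRestricted : RangeRestricted (Pₖ k)
  rangeRestricted _ (here refl) x (here refl) = bodyA k , here refl , here refl
  rangeRestricted _ (here refl) x (there x∈)  = bodyA k , here refl ,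
    there (subst (x ∈_) (sym (varsTs-++ (Xs 0 k) (const 1 ∷ []))) (∈-++⁺ˡ x∈))
  oneSideSimple : ∀ r → r ∈ Pₖ k → ∀ t u b x → t ∈ targs (head r) → b ∈ body r → u ∈ targs b →
                  x ∈ varsT t → x ∈ varsT u → Simple t ⊎ Simple u
  oneSideSimple _ (here refl) t u _ x _ (here refl) u∈ _ _ = inj₂ (body-simple k u∈)
  shallow : ∀ a → OccursAtom (Pₖ k) a → ∀ t → t ∈ targs a → NestingAtMostOne t
  shallow _ (_ , here refl , inj₁ refl) _ (here refl) =
    inj₂ (0 , var 0 ∷ [] , refl , inj₁ (0 , refl) ∷ [])
  shallow _ (_ , here refl , inj₁ refl) _ (there (here refl)) = inj₁ (inj₂ (0 , refl))
  shallow _ (_ , here refl , inj₁ refl) _ (there (there t∈)) =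
    inj₁ (inj₁ (let (m , t≡) = ∈Xs 0 k t∈ in suc m , t≡))
  shallow _ (_ , here refl , inj₂ (here refl)) _ t∈ = inj₁ (body-simple k t∈)

fⁱZ : ℕ → Term
fⁱZ zero    = var 0
fⁱZ (suc i) = fn 0 (fⁱZ i ∷ [])

-- θ i instantiates the rule after i firings: Z ↦ fⁱ(Z), X₁..Xᵢ ↦ a, the rest ↦ b.
θ : ℕ → Subst
θ i zero    = fⁱZ i
θ i (suc j) = if j <ᵇ i then const 0 else const 1

θ-shift : ∀ i s n → subs (θ (suc i)) (Xs (suc s) n) ≡ subs (θ i) (Xs s n)
θ-shift i s zero    = refl
θ-shift i s (suc n) = cong (_ ∷_) (θ-shift i (suc s) n)

-- for i ≤ k the variable X_{k+1} is not among the first i, so θᵢ sends it to b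
<ᵇ-false : ∀ i k → i ≤ k → (k <ᵇ i) ≡ false
<ᵇ-false zero    k       _         = refl
<ᵇ-false (suc i) (suc k) (s≤s i≤k) = <ᵇ-false i k i≤k

Xs-snoc : ∀ s n → Xs s (suc n) ≡ Xs s n ++ var (suc (s + n)) ∷ []
Xs-snoc s zero    = cong (λ m → var (suc m) ∷ []) (sym (+-identityʳ s))
Xs-snoc s (suc n) = cong (var (suc s) ∷_)
  (trans (Xs-snoc (suc s) n) (cong (λ m → Xs (suc s) n ++ var (suc m) ∷ []) (sym (+-suc s n))))

head≡body : ∀ i k → i < k → subA (θ i) (headA k) ≡ subA (θ (suc i)) (bodyA k)
head≡body i (suc k) (s≤s i≤k) = cong (λ ts → atom 0 (fn 0 (fⁱZ i ∷ []) ∷ const 0 ∷ ts)) (begin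
    subs (θ i) (Xs 0 (suc k))
  ≡⟨ cong (subs (θ i)) (Xs-snoc 0 k) ⟩
    subs (θ i) (Xs 0 k ++ var (suc k) ∷ [])
  ≡⟨ subs-++ (θ i) (Xs 0 k) _ ⟩
    subs (θ i) (Xs 0 k) ++ (if k <ᵇ i then const 0 else const 1) ∷ []
  ≡⟨ cong (λ c → subs (θ i) (Xs 0 k) ++ (if c then const 0 else const 1) ∷ []) (<ᵇ-false i k i≤k) ⟩
    subs (θ i) (Xs 0 k) ++ const 1 ∷ []
  ≡⟨ cong (_++ const 1 ∷ []) (sym (θ-shift i 0 k)) ⟩
    subs (θ (suc i)) (Xs 1 k) ++ const 1 ∷ []
  ≡⟨ sym (subs-++ (θ (suc i)) (Xs 1 k) _) ⟩
    subs (θ (suc i)) (Xs 1 k ++ const 1 ∷ [])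
  ∎)
  where open ≡-Reasoning

active-chain : ∀ k n i → i + suc n ≤ k → ∀ h σ → subA σ h ≡ subA (θ i) (headA k) →
               Act (Pₖ k) h (suc n) (ruleₖ k)
active-chain k zero i bound h σ h≡ =
  last σ (θ (suc i)) (here refl) (here refl) (trans h≡ (head≡body i k i<k))
  where i<k = subst (_≤ k) (+-comm i 1) bound
active-chain k (suc n) i bound h σ h≡ =
  step σ (θ (suc i)) (here refl) (here refl) (trans h≡ (head≡body i k i<k))
    (active-chain k n (suc i) bound′ _ var (subA-id _))
  where
  bound′ = subst (_≤ k) (+-suc i (suc n)) bound
  i<k    = ≤-trans (s≤s (m≤m+n i (suc n))) bound′

cyclic-upto-k : ∀ k j → 1 ≤ j → j ≤ k → DependsOnCycle (Pₖ k) j (ruleₖ k)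
cyclic-upto-k k (suc n) _ j≤k =
  ruleₖ k , [ here refl , active-chain k n 0 j≤k (headA k) (θ 0) refl ] , ε

APrefix : ℕ → Atom → Set
APrefix i h = ∀ j → j ≤ i → nth (targs h) (suc j) ≡ just (const 0)

-- position k+1 of the body holds b, so a-prefix i can only meet the body if i < k
prefix-fits : ∀ k i h σ τ → APrefix i h → subA σ h ≡ subA τ (bodyA k) → i < k
prefix-fits k i h σ τ prefix h≡b with i <? k
... | yes i<k = i<k
... | no  i≮k = ⊥-elim (a≢b (just-injective (begin
    just (const 0)                           ≡⟨ sym (cong (Maybe.map (sub σ)) (prefix k (≮⇒≥ i≮k))) ⟩
    Maybe.map (sub σ) (nth (targs h) (suc k)) ≡⟨ sym (nth-subs σ (targs h) (suc k)) ⟩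
    nth (subs σ (targs h)) (suc k)           ≡⟨ cong (λ ts → nth ts (suc k)) (cong targs h≡b) ⟩
    nth (subs τ (targs (bodyA k))) (suc k)   ≡⟨ nth-subs τ (bodyTail k) k ⟩
    Maybe.map (sub τ) (nth (bodyTail k) k)   ≡⟨ cong (Maybe.map (sub τ)) b-at-k ⟩
    just (const 1)                           ∎)))
  where
  open ≡-Reasoning
  a≢b : const 0 ≢ const 1
  a≢b ()
  b-at-k : nth (bodyTail k) k ≡ just (const 1)
  b-at-k = subst (λ m → nth (bodyTail k) m ≡ just (const 1)) (length-Xs 0 k) (nth-length (Xs 0 k) (const 1) [])

prefix-grows : ∀ k i h σ τ → APrefix i h → subA σ h ≡ subA τ (bodyA k) → i < k →
               APrefix (suc i) (subA τ (headA k))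
prefix-grows k i h σ τ prefix h≡b i<k zero    _         = refl
prefix-grows k i h σ τ prefix h≡b i<k (suc j) (s≤s j≤i) = begin
    nth (subs τ (Xs 0 k)) j                             ≡⟨ nth-subs τ (Xs 0 k) j ⟩
    Maybe.map (sub τ) (nth (Xs 0 k) j)                  ≡⟨ cong (Maybe.map (sub τ)) (sym (nth-++ˡ (Xs 0 k) _ j j<len)) ⟩
    Maybe.map (sub τ) (nth (bodyTail k) j)              ≡⟨ sym (nth-subs τ (bodyTail k) j) ⟩
    nth (subs τ (targs (bodyA k))) (suc j)              ≡⟨ cong (λ ts → nth ts (suc j)) (sym (cong targs h≡b)) ⟩
    nth (subs σ (targs h)) (suc j)                      ≡⟨ nth-subs σ (targs h) (suc j) ⟩
    Maybe.map (sub σ) (nth (targs h) (suc j))           ≡⟨ cong (Maybe.map (sub σ)) (prefix j j≤i) ⟩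
    just (const 0)                                      ∎
  where
  open ≡-Reasoning
  j<len = subst (j <_) (sym (length-Xs 0 k)) (≤-trans (s≤s j≤i) i<k)

active-bound : ∀ k {h n s} i → Act (Pₖ k) h n s → APrefix i h → i + n ≤ k
active-bound k i (last σ τ (here refl) (here refl) h≡b) prefix =
  subst (_≤ k) (+-comm 1 i) (prefix-fits k i _ σ τ prefix h≡b)
active-bound k {n = suc n} i (step σ τ (here refl) (here refl) h≡b rest) prefix =
  subst (_≤ k) (sym (+-suc i n))
    (active-bound k (suc i) rest (prefix-grows k i _ σ τ prefix h≡b (prefix-fits k i _ σ τ prefix h≡b)))

acyclic-at-k+1 : ∀ k r → ¬ DependsOnCycle (Pₖ k) (suc k) r
acyclic-at-k+1 k r (c , c⁺c , _) = noEdge (firstEdge c⁺c)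
  where
  firstEdge : ∀ {y} → TransClosure (ΣEdge (Pₖ k) (suc k)) c y → ∃[ z ] ΣEdge (Pₖ k) (suc k) c z
  firstEdge [ e ]   = _ , e
  firstEdge (e ∷ _) = _ , e
  noEdge : ¬ (∃[ z ] ΣEdge (Pₖ k) (suc k) c z)
  noEdge (_ , here refl , act) = <-irrefl refl (active-bound k 0 act (λ { zero _ → refl }))

p₀ : ℕ → Arg
p₀ k = predOf (headA k) , 0

D-candidate : ℕ → (Arg → ℕ) → ℕ × Term → List ℤ
D-candidate k φ ju = ((+ 1) ℤ.- (+ depth 0 (proj₂ ju))) ℤ.+ (+ φ (predOf (bodyA k) , proj₁ ju)) ∷ []

Ω-p₀ : ∀ k φ → Ω (Pₖ k) φ (p₀ k) ≡ suc (φ (predOf (bodyA k) , 0))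
Ω-p₀ k φ rewrite ≟P-refl (predOf (headA k))
               | absent-no-candidates 0 (D-candidate k φ) 1 (bodyTail k) (Z-absent k) = refl

-- since head and body share the predicate, Ωᵐ(φ₀)(p[0]) = m
Ωiter-p₀ : ∀ k m → Ωiter (Pₖ k) m (p₀ k) ≡ m
Ωiter-p₀ k zero    = refl
Ωiter-p₀ k (suc m) = trans (Ω-p₀ k (Ωiter (Pₖ k) m))
  (cong suc (trans (cong (λ q → Ωiter (Pₖ k) m (q , 0)) (samePred k)) (Ωiter-p₀ k m)))

p₀∉AR : ∀ k → ¬ AR (Pₖ k) (p₀ k)
p₀∉AR k (_ , n , constant) =
  1+n≢n (subst₂ _≡_ (Ωiter-p₀ k (suc n)) (Ωiter-p₀ k n) (constant (suc n) (n≤1+n n)))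

f-loop : ∀ k → GEdge (Pₖ k) (p₀ k) (p₀ k) (lab (0 , 1))
f-loop k = subst (λ q → GEdge (Pₖ k) (q , 0) (p₀ k) (lab (0 , 1))) (samePred k)
  (fwd {x = 0} {ts = var 0 ∷ []} (here refl) (here refl) refl refl (here refl))

-- the one-letter word f is produced by S → S₁ f S₂ with S₁, S₂ → ε
p₀∉GA : ∀ k → ¬ GA (Pₖ k) (p₀ k)
p₀∉GA k (_ , noBadCycle) = noBadCycle
  (p₀ k , ⟨ 0 , 1 ⟩ ∷ [] , (p₀ k , lab (0 , 1) , [] , (f-loop k , p₀∉AR k) , nil , refl) ,
   sS {w₁ = []} {w₂ = []} s1ε s2ε , [] , nil)

head-mixed : ∀ k → ¬ AllSimpleOrAllComplex (headA k)
head-mixed k (inj₁ (inj₁ (_ , ()) ∷ _))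
head-mixed k (inj₁ (inj₂ (_ , ()) ∷ _))
head-mixed k (inj₂ (_ ∷ (_ , _ , ()) ∷ _))

p₀∉Ψiter : ∀ k m → ¬ Ψiter (Pₖ k) k m (p₀ k)
p₀∉Ψiter k zero    inGA              = p₀∉GA k inGA
p₀∉Ψiter k (suc m) (_ , eachRule) with eachRule (ruleₖ k) (here refl) refl (fn 0 (var 0 ∷ [])) refl
... | inj₁ (j , 1≤j , j≤k , acyclic) = acyclic (cyclic-upto-k k j 1≤j j≤k)
... | inj₂ (inj₂ (_ , headShape , _)) = head-mixed k headShape
... | inj₂ (inj₁ fromBody) with fromBody 0 (here refl)
...   | _ , zero  , _ , here refl , _     , _   , Ap₀ =
          p₀∉Ψiter k m (subst (λ q → Ψiter (Pₖ k) k m (q , 0)) (samePred k) Ap₀)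
...   | _ , suc j , _ , here refl , bj≡u , Z∈u , _ =
          Z∉bodyTail k (nth-∈ (bodyTail k) j bj≡u) Z∈u

p₀∈args : ∀ k → InArgs (Pₖ k) (p₀ k)
p₀∈args k = headA k , ((ruleₖ k , here refl , inj₁ refl) , refl) , s≤s z≤n

Pₖ-not-k-safe : ∀ k → ¬ KSafe k (Pₖ k)
Pₖ-not-k-safe k safe = let (n , eventually) = safe (p₀ k) (p₀∈args k) in
  p₀∉Ψiter k n (eventually n ≤-refl)

-- Pₖ is (k+1)-safe: no rule depends on a cycle of Σₖ₊₁(Pₖ)

Pₖ-k+1-safe : ∀ k → KSafe (suc k) (Pₖ k)
Pₖ-k+1-safe k a inArgs = 1 , λ { (suc m) _ →
  inArgs , λ r _ _ _ _ → inj₁ (suc k , s≤s z≤n , ≤-refl , acyclic-at-k+1 k r) }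

proposition7 : (k : ℕ) → 1 ≤ k →
    ((P : Program) → InClass P → KSafe k P → KSafe (suc k) P) ×
    Σ Program (λ P → InClass P × KSafe (suc k) P × ¬ KSafe k P)
proposition7 k _ =
  (λ P _ → ksafe-mono k P) ,
  (Pₖ k , Pₖ-inClass k , Pₖ-k+1-safe k , Pₖ-not-k-safe k)
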